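{- Let $K$ be a flag simplicial $2$-sphere and $e$ an edge of $K$. Then the simplicial sphere $K/e$ is flag if and only if $e$ is not contained in any belt of $K$.
   Context: A simplicial complex is flag if every set of pairwise adjacent vertices spans a simplex. For an edge $e=\{v_1,v_2\}$, $K/e$ is obtained by replacing $\operatorname{st}_K v_1\cup \operatorname{st}_K v_2$ by the star of a new vertex $v$ (topologically shrink $e$, identify multiple edges, remove degenerate faces). A set of four vertices $\{v_1,v_2,v_3,v_4\}$ of $K$ is a belt if the full subcomplex of $K$ on these vertices is the boundary of a square (a $4$-cycle with no diagonals). An edge is contained in a belt if both its endpoints belong to the belt and it is an edge of that $4$-cycle. -}

module Defs where

open import Data.Nat using (ℕ; zero; suc; _+_; _≤_; _≡ᵇ_)
open import Data.Bool using (Bool; true; false; T; _∧_; if_then_else_)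
open import Data.Fin using (Fin; _≟_)
open import Data.Fin.Subset using (Subset; _∈_; _∉_; _⊆_; _∪_; ⁅_⁆; ∣_∣)
open import Data.Vec using (_∷_; [])
open import Data.List using (List; _∷_; []; map; _++_; filter; length)
open import Data.Product using (Σ; ∃; _×_; _,_)
open import Data.Sum using (_⊎_)
open import Relation.Nullary using (¬_; yes; no)
open import Relation.Nullary.Decidable using (⌊_⌋)
open import Relation.Binary.PropositionalEquality using (_≡_; _≢_)
open import Relation.Binary.Construct.Closure.ReflexiveTransitive using (Star)
open import Function.Bundles using (_⇔_)

pair : ∀ {n} → Fin n → Fin n → Subset n
pair a b = ⁅ a ⁆ ∪ ⁅ b ⁆

triple : ∀ {n} → Fin n → Fin n → Fin n → Subset n
triple a b c = ⁅ a ⁆ ∪ ⁅ b ⁆ ∪ ⁅ c ⁆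

module _ {n : ℕ} (F : Subset n → Set) where

  IsVertex : Fin n → Set
  IsVertex i = F ⁅ i ⁆

  IsEdge : Fin n → Fin n → Set
  IsEdge i j = i ≢ j × F (pair i j)

  Flag : Set
  Flag = ∀ (σ : Subset n)
       → (∀ i → i ∈ σ → IsVertex i)
       → (∀ i j → i ∈ σ → j ∈ σ → i ≢ j → F (pair i j))
       → F σ

record Complex (n : ℕ) : Set where
  field
    face : Subset n → Bool
    down : ∀ σ τ → T (face σ) → τ ⊆ σ → T (face τ)

Face : ∀ {n} → Complex n → Subset n → Set
Face K σ = T (Complex.face K σ)

subsets : (n : ℕ) → List (Subset n)
subsets zero = [] ∷ []
subsets (suc n) = map (false ∷_) (subsets n) ++ map (true ∷_) (subsets n)

numFaces : ∀ {n} → Complex n → ℕ → ℕ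
numFaces {n} K k =
  length (filter (λ σ → T? (Complex.face K σ ∧ (∣ σ ∣ ≡ᵇ k))) (subsets n))
  where
  open import Data.Bool using (T?)

-- Simplicial 2-sphere, defined combinatorially: a connected closed
-- combinatorial surface (pure 2-dimensional, every edge in exactly two
-- triangles, every vertex link a circle) of Euler characteristic 2.
-- (By the classification of surfaces this is exactly a triangulation of S².)

module _ {n : ℕ} (K : Complex n) where

  private
    F = Face K

  EdgeInExactlyTwoTriangles : Fin n → Fin n → Set
  EdgeInExactlyTwoTriangles a b =
    Σ (Fin n) λ c → Σ (Fin n) λ d →
      c ≢ d × c ≢ a × c ≢ b × d ≢ a × d ≢ b ×
      F (triple a b c) × F (triple a b d) ×
      (∀ x → x ≢ a → x ≢ b → F (triple a b x) → x ≡ c ⊎ x ≡ d)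

  LinkVertex : Fin n → Fin n → Set
  LinkVertex v a = IsEdge F v a

  LinkEdge : Fin n → Fin n → Fin n → Set
  LinkEdge v x y = x ≢ y × x ≢ v × y ≢ v × F (triple v x y)

  Adjacent : Fin n → Fin n → Set
  Adjacent x y = IsEdge F x y

  record IsSphere2 : Set where
    field
      dim≤2      : ∀ σ → F σ → ∣ σ ∣ ≤ 3
      vertexInEdge : ∀ v → IsVertex F v → ∃ λ w → IsEdge F v w
      edgeTwo    : ∀ a b → IsEdge F a b → EdgeInExactlyTwoTriangles a b
      linkConn   : ∀ v → IsVertex F v → ∀ a b → LinkVertex v a → LinkVertex v b
                   → Star (LinkEdge v) a b
      connected  : ∀ u w → IsVertex F u → IsVertex F w → Star Adjacent u w
      euler      : numFaces K 1 + numFaces K 3 ≡ numFaces K 2 + 2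

-- Edge contraction K/e for e = {a,b}: the image of K under the vertex map
-- sending b to a and fixing all other vertices (this shrinks e, identifies
-- multiple edges and removes degenerate faces). The new vertex is named a;
-- b is no longer a vertex of K/e.

merge : ∀ {n} → Fin n → Fin n → Fin n → Fin n
merge a b j = if ⌊ j ≟ b ⌋ then a else j

Contract : ∀ {n} → Complex n → Fin n → Fin n → Subset n → Set
Contract {n} K a b τ =
  Σ (Subset n) λ σ → Face K σ ×
    (∀ i → (i ∈ τ) ⇔ (∃ λ j → j ∈ σ × merge a b j ≡ i))

module _ {n : ℕ} (K : Complex n) where

  private
    F = Face K

  IsBelt : Fin n → Fin n → Fin n → Fin n → Set
  IsBelt v1 v2 v3 v4 =
    v1 ≢ v2 × v1 ≢ v3 × v1 ≢ v4 × v2 ≢ v3 × v2 ≢ v4 × v3 ≢ v4 ×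
    F (pair v1 v2) × F (pair v2 v3) × F (pair v3 v4) × F (pair v4 v1) ×
    ¬ F (pair v1 v3) × ¬ F (pair v2 v4) ×
    (∀ σ → F σ → σ ⊆ (⁅ v1 ⁆ ∪ ⁅ v2 ⁆ ∪ ⁅ v3 ⁆ ∪ ⁅ v4 ⁆) → ∣ σ ∣ ≤ 2)

  SameEdge : Fin n → Fin n → Fin n → Fin n → Set
  SameEdge a b x y = (a ≡ x × b ≡ y) ⊎ (a ≡ y × b ≡ x)

  EdgeInBelt : Fin n → Fin n → Set
  EdgeInBelt a b =
    Σ (Fin n) λ v1 → Σ (Fin n) λ v2 → Σ (Fin n) λ v3 → Σ (Fin n) λ v4 →
      IsBelt v1 v2 v3 v4 ×
      (SameEdge a b v1 v2 ⊎ SameEdge a b v2 v3 ⊎ SameEdge a b v3 v4 ⊎ SameEdge a b v4 v1)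

{-# OPTIONS --safe #-}
module Submission where

-- A missing face of K/e is a clique τ of K/e through the new vertex a.
-- If every other vertex of τ is adjacent in K to a (or to b), then τ (or τ with
-- a replaced by b) is a clique of K, hence a face, and maps onto τ. Otherwise
-- some x ∈ τ is not adjacent to a and some y ∈ τ is not adjacent to b; being
-- adjacent to the contracted vertex, x is adjacent to b and y to a, and a b x y
-- is an induced 4-cycle, i.e. a belt through e. Conversely, for a belt a b x y
-- the triangle {a, x, y} is a clique of K/e which is not the image of any face.

open import Defs
open import Data.Nat using (ℕ; _+_; _≤_; z≤n; s≤s)
open import Data.Nat.Properties using (≤-trans; ≤-reflexive; +-monoʳ-≤; n≤1+n; +-suc)
open import Data.Fin using (Fin; _≟_)
open import Data.Fin.Properties using (any?)
open import Data.Fin.Subset using (Subset; _∈_; _∉_; _⊆_; _∪_; _∩_; ∁; ⁅_⁆; ∣_∣; inside; outside)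
open import Data.Fin.Subset.Properties
  using (x∈⁅x⁆; x∈⁅y⁆⇒x≡y; ∣⁅x⁆∣≡1; x∈p∪q⁻; x∈p∪q⁺; x∈p∩q⁺; x∈p∩q⁻; x∈∁p⇒x∉p; x∉p⇒x∈∁p;
         p⊆q⇒∣p∣≤∣q∣; ∪-comm; _∈?_)
open import Data.Vec using (_∷_; [])
open import Data.Bool using (T?)
open import Data.Product using (∃; ∃₂; _×_; _,_; proj₁; proj₂)
open import Data.Sum using (_⊎_; inj₁; inj₂; [_,_])
open import Data.Empty using (⊥-elim)
open import Relation.Nullary using (¬_; yes; no)
open import Relation.Nullary.Decidable using (¬?; _×-dec_; decidable-stable)
open import Relation.Binary.PropositionalEquality using (_≡_; _≢_; refl; sym; subst; cong₂; ≢-sym)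
open import Function.Bundles using (_⇔_; mk⇔; Equivalence)

∣p∪q∣≤∣p∣+∣q∣ : ∀ {n} (p q : Subset n) → ∣ p ∪ q ∣ ≤ ∣ p ∣ + ∣ q ∣
∣p∪q∣≤∣p∣+∣q∣ []           []           = z≤n
∣p∪q∣≤∣p∣+∣q∣ (inside ∷ p)  (inside ∷ q)  =
  s≤s (≤-trans (∣p∪q∣≤∣p∣+∣q∣ p q) (+-monoʳ-≤ ∣ p ∣ (n≤1+n ∣ q ∣)))
∣p∪q∣≤∣p∣+∣q∣ (inside ∷ p)  (outside ∷ q) = s≤s (∣p∪q∣≤∣p∣+∣q∣ p q)
∣p∪q∣≤∣p∣+∣q∣ (outside ∷ p) (inside ∷ q)  rewrite +-suc ∣ p ∣ ∣ q ∣ = s≤s (∣p∪q∣≤∣p∣+∣q∣ p q)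
∣p∪q∣≤∣p∣+∣q∣ (outside ∷ p) (outside ∷ q) = ∣p∪q∣≤∣p∣+∣q∣ p q

module _ {n : ℕ} where

  pair-comm : ∀ (u v : Fin n) → pair u v ≡ pair v u
  pair-comm u v = ∪-comm ⁅ u ⁆ ⁅ v ⁆

  x∈pair⁻ : ∀ {x u v : Fin n} → x ∈ pair u v → x ≡ u ⊎ x ≡ v
  x∈pair⁻ {u = u} {v} x∈ with x∈p∪q⁻ ⁅ u ⁆ ⁅ v ⁆ x∈
  ... | inj₁ x∈u = inj₁ (x∈⁅y⁆⇒x≡y u x∈u)
  ... | inj₂ x∈v = inj₂ (x∈⁅y⁆⇒x≡y v x∈v)

  u∈pair : ∀ (u v : Fin n) → u ∈ pair u v
  u∈pair u v = x∈p∪q⁺ (inj₁ (x∈⁅x⁆ u))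

  v∈pair : ∀ (u v : Fin n) → v ∈ pair u v
  v∈pair u v = x∈p∪q⁺ (inj₂ (x∈⁅x⁆ v))

  pair⊆ : ∀ {u v : Fin n} {σ} → u ∈ σ → v ∈ σ → pair u v ⊆ σ
  pair⊆ u∈σ v∈σ x∈ with x∈pair⁻ x∈
  ... | inj₁ refl = u∈σ
  ... | inj₂ refl = v∈σ

  ⁅x⁆⊆ : ∀ {x : Fin n} {σ} → x ∈ σ → ⁅ x ⁆ ⊆ σ
  ⁅x⁆⊆ {x} x∈σ y∈ with x∈⁅y⁆⇒x≡y x y∈
  ... | refl = x∈σ

  ∣pair∣≤2 : ∀ (u v : Fin n) → ∣ pair u v ∣ ≤ 2
  ∣pair∣≤2 u v = ≤-trans (∣p∪q∣≤∣p∣+∣q∣ ⁅ u ⁆ ⁅ v ⁆)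
                         (≤-reflexive (cong₂ _+_ (∣⁅x⁆∣≡1 u) (∣⁅x⁆∣≡1 v)))

  x∈triple⁻ : ∀ {x u v w : Fin n} → x ∈ triple u v w → x ≡ u ⊎ x ≡ v ⊎ x ≡ w
  x∈triple⁻ {u = u} {v} {w} x∈ with x∈p∪q⁻ ⁅ u ⁆ (pair v w) x∈
  ... | inj₁ x∈u  = inj₁ (x∈⁅y⁆⇒x≡y u x∈u)
  ... | inj₂ x∈vw = inj₂ (x∈pair⁻ x∈vw)

  u∈triple : ∀ (u v w : Fin n) → u ∈ triple u v w
  u∈triple u v w = x∈p∪q⁺ (inj₁ (x∈⁅x⁆ u))

  v∈triple : ∀ (u v w : Fin n) → v ∈ triple u v w
  v∈triple u v w = x∈p∪q⁺ (inj₂ (u∈pair v w))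

  w∈triple : ∀ (u v w : Fin n) → w ∈ triple u v w
  w∈triple u v w = x∈p∪q⁺ (inj₂ (v∈pair v w))

  triple-all : ∀ {P : Fin n → Set} {u v w} → P u → P v → P w →
               ∀ i → i ∈ triple u v w → P i
  triple-all pu pv pw i i∈ with x∈triple⁻ i∈
  ... | inj₁ refl        = pu
  ... | inj₂ (inj₁ refl) = pv
  ... | inj₂ (inj₂ refl) = pw

  triple-pairwise : ∀ {R : Fin n → Fin n → Set} {u v w} → (∀ {i j} → R i j → R j i) →
                    R u v → R u w → R v w →
                    ∀ i j → i ∈ triple u v w → j ∈ triple u v w → i ≢ j → R i j
  triple-pairwise sym-R ruv ruw rvw i j i∈ j∈ i≢j with x∈triple⁻ i∈ | x∈triple⁻ j∈
  ... | inj₁ refl        | inj₁ refl        = ⊥-elim (i≢j refl)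
  ... | inj₁ refl        | inj₂ (inj₁ refl) = ruv
  ... | inj₁ refl        | inj₂ (inj₂ refl) = ruw
  ... | inj₂ (inj₁ refl) | inj₁ refl        = sym-R ruv
  ... | inj₂ (inj₁ refl) | inj₂ (inj₁ refl) = ⊥-elim (i≢j refl)
  ... | inj₂ (inj₁ refl) | inj₂ (inj₂ refl) = rvw
  ... | inj₂ (inj₂ refl) | inj₁ refl        = sym-R ruw
  ... | inj₂ (inj₂ refl) | inj₂ (inj₁ refl) = sym-R rvw
  ... | inj₂ (inj₂ refl) | inj₂ (inj₂ refl) = ⊥-elim (i≢j refl)

  at-most-one : ∀ {σ : Subset n} {u w} → ¬ (u ∈ σ × w ∈ σ) →
                ∃ λ p → ∀ {i} → i ∈ σ → i ≡ u ⊎ i ≡ w → i ≡ p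
  at-most-one {σ} {u} {w} ¬both with u ∈? σ
  ... | yes u∈σ = u , λ { _ (inj₁ refl) → refl ; w∈σ (inj₂ refl) → ⊥-elim (¬both (u∈σ , w∈σ)) }
  ... | no  u∉σ = w , λ { u∈σ (inj₁ refl) → ⊥-elim (u∉σ u∈σ) ; _ (inj₂ refl) → refl }

  ∣σ∣≤2-without-diagonals : ∀ {σ : Subset n} {v₁ v₂ v₃ v₄} →
                            σ ⊆ ⁅ v₁ ⁆ ∪ triple v₂ v₃ v₄ →
                            ¬ (v₁ ∈ σ × v₃ ∈ σ) → ¬ (v₂ ∈ σ × v₄ ∈ σ) → ∣ σ ∣ ≤ 2
  ∣σ∣≤2-without-diagonals {σ} {v₁} σ⊆ ¬d₁₃ ¬d₂₄
    with at-most-one ¬d₁₃ | at-most-one ¬d₂₄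
  ... | p , to-p | q , to-q = ≤-trans (p⊆q⇒∣p∣≤∣q∣ σ⊆pq) (∣pair∣≤2 p q)
    where
    left : ∀ {i} → i ≡ p → i ∈ pair p q
    left refl = u∈pair p q

    right : ∀ {i} → i ≡ q → i ∈ pair p q
    right refl = v∈pair p q

    σ⊆pq : σ ⊆ pair p q
    σ⊆pq i∈σ with x∈p∪q⁻ ⁅ v₁ ⁆ _ (σ⊆ i∈σ)
    ... | inj₁ i∈v₁ = left (to-p i∈σ (inj₁ (x∈⁅y⁆⇒x≡y v₁ i∈v₁)))
    ... | inj₂ i∈v₂₃₄ with x∈triple⁻ i∈v₂₃₄
    ...   | inj₁ i≡v₂        = right (to-q i∈σ (inj₁ i≡v₂))
    ...   | inj₂ (inj₁ i≡v₃) = left (to-p i∈σ (inj₂ i≡v₃))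
    ...   | inj₂ (inj₂ i≡v₄) = right (to-q i∈σ (inj₂ i≡v₄))

module _ {n : ℕ} (K : Complex n) where

  private
    F = Face K

  face-⊆ : ∀ {σ τ} → F σ → τ ⊆ σ → F τ
  face-⊆ {σ} {τ} f τ⊆σ = Complex.down K σ τ f τ⊆σ

  edge-comm : ∀ {u v} → F (pair u v) → F (pair v u)
  edge-comm {u} {v} = subst F (pair-comm u v)

  record Square (v₁ v₂ v₃ v₄ : Fin n) : Set where
    field
      edge₁₂ : F (pair v₁ v₂)
      edge₂₃ : F (pair v₂ v₃)
      edge₃₄ : F (pair v₃ v₄)
      edge₄₁ : F (pair v₄ v₁)
      no-diagonal₁₃ : ¬ F (pair v₁ v₃)
      no-diagonal₂₄ : ¬ F (pair v₂ v₄)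

  open Square

  square-rotate : ∀ {v₁ v₂ v₃ v₄} → Square v₁ v₂ v₃ v₄ → Square v₂ v₃ v₄ v₁
  square-rotate sq = record
    { edge₁₂ = edge₂₃ sq ; edge₂₃ = edge₃₄ sq ; edge₃₄ = edge₄₁ sq ; edge₄₁ = edge₁₂ sq
    ; no-diagonal₁₃ = no-diagonal₂₄ sq
    ; no-diagonal₂₄ = λ f → no-diagonal₁₃ sq (edge-comm f) }

  square-reflect : ∀ {v₁ v₂ v₃ v₄} → Square v₁ v₂ v₃ v₄ → Square v₂ v₁ v₄ v₃
  square-reflect sq = record
    { edge₁₂ = edge-comm (edge₁₂ sq) ; edge₂₃ = edge-comm (edge₄₁ sq)
    ; edge₃₄ = edge-comm (edge₃₄ sq) ; edge₄₁ = edge-comm (edge₂₃ sq)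
    ; no-diagonal₁₃ = no-diagonal₂₄ sq ; no-diagonal₂₄ = no-diagonal₁₃ sq }

  -- Identifying two vertices of a square would turn an edge into a diagonal.
  square-adjacent-≢ : ∀ {v₁ v₂ v₃ v₄} → Square v₁ v₂ v₃ v₄ → v₁ ≢ v₂
  square-adjacent-≢ sq refl = no-diagonal₂₄ sq (edge-comm (edge₄₁ sq))

  square-opposite-≢ : ∀ {v₁ v₂ v₃ v₄} → Square v₁ v₂ v₃ v₄ → v₁ ≢ v₃
  square-opposite-≢ {v₁} {v₂} sq refl =
    no-diagonal₁₃ sq (face-⊆ (edge₁₂ sq) (pair⊆ (u∈pair v₁ v₂) (u∈pair v₁ v₂)))

  square⇒belt : ∀ {v₁ v₂ v₃ v₄} → Square v₁ v₂ v₃ v₄ → IsBelt K v₁ v₂ v₃ v₄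
  square⇒belt sq =
      square-adjacent-≢ sq , square-opposite-≢ sq
    , ≢-sym (square-adjacent-≢ (square-rotate (square-rotate (square-rotate sq))))
    , square-adjacent-≢ (square-rotate sq) , square-opposite-≢ (square-rotate sq)
    , square-adjacent-≢ (square-rotate (square-rotate sq))
    , edge₁₂ sq , edge₂₃ sq , edge₃₄ sq , edge₄₁ sq , no-diagonal₁₃ sq , no-diagonal₂₄ sq
    , λ σ f σ⊆ → ∣σ∣≤2-without-diagonals σ⊆
        (λ (i∈ , j∈) → no-diagonal₁₃ sq (face-⊆ f (pair⊆ i∈ j∈)))
        (λ (i∈ , j∈) → no-diagonal₂₄ sq (face-⊆ f (pair⊆ i∈ j∈)))

  belt⇒square : ∀ {v₁ v₂ v₃ v₄} → IsBelt K v₁ v₂ v₃ v₄ → Square v₁ v₂ v₃ v₄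
  belt⇒square (_ , _ , _ , _ , _ , _ , e₁₂ , e₂₃ , e₃₄ , e₄₁ , ¬d₁₃ , ¬d₂₄ , _) =
    record { edge₁₂ = e₁₂ ; edge₂₃ = e₂₃ ; edge₃₄ = e₃₄ ; edge₄₁ = e₄₁
           ; no-diagonal₁₃ = ¬d₁₃ ; no-diagonal₂₄ = ¬d₂₄ }

  square⇒edgeInBelt : ∀ {a b x y} → Square a b x y → EdgeInBelt K a b
  square⇒edgeInBelt sq = _ , _ , _ , _ , square⇒belt sq , inj₁ (inj₁ (refl , refl))

  edgeInBelt⇒square : ∀ {a b} → EdgeInBelt K a b → ∃₂ λ x y → Square a b x y
  edgeInBelt⇒square (_ , _ , _ , _ , belt , side) with belt⇒square belt | side
  ... | sq | inj₁ (inj₁ (refl , refl))                   = _ , _ , sq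
  ... | sq | inj₁ (inj₂ (refl , refl))                   = _ , _ , square-reflect sq
  ... | sq | inj₂ (inj₁ (inj₁ (refl , refl)))            = _ , _ , square-rotate sq
  ... | sq | inj₂ (inj₁ (inj₂ (refl , refl)))            = _ , _ , square-reflect (square-rotate sq)
  ... | sq | inj₂ (inj₂ (inj₁ (inj₁ (refl , refl))))     = _ , _ , square-rotate (square-rotate sq)
  ... | sq | inj₂ (inj₂ (inj₁ (inj₂ (refl , refl))))     =
    _ , _ , square-reflect (square-rotate (square-rotate sq))
  ... | sq | inj₂ (inj₂ (inj₂ (inj₁ (refl , refl))))     =
    _ , _ , square-rotate (square-rotate (square-rotate sq))
  ... | sq | inj₂ (inj₂ (inj₂ (inj₂ (refl , refl))))     =
    _ , _ , square-reflect (square-rotate (square-rotate (square-rotate sq)))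

  adjacent-to-all-or-counterexample :
    ∀ (τ : Subset n) (a c : Fin n) →
    (∀ j → j ∈ τ → j ≢ a → F (pair c j)) ⊎ (∃ λ j → j ∈ τ × j ≢ a × ¬ F (pair c j))
  adjacent-to-all-or-counterexample τ a c
    with any? (λ j → (j ∈? τ) ×-dec ¬? (j ≟ a) ×-dec ¬? (T? (Complex.face K (pair c j))))
  ... | yes counterexample = inj₂ counterexample
  ... | no  none = inj₁ λ j j∈τ j≢a →
          decidable-stable (T? _) (λ ¬f → none (j , j∈τ , j≢a , ¬f))

module _ {n : ℕ} {a b : Fin n} where

  merge-b : merge a b b ≡ a
  merge-b with b ≟ b
  ... | yes _   = refl
  ... | no  b≢b = ⊥-elim (b≢b refl)

  merge-fix : ∀ {j} → j ≢ b → merge a b j ≡ j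
  merge-fix {j} j≢b with j ≟ b
  ... | yes j≡b = ⊥-elim (j≢b j≡b)
  ... | no  _   = refl

  merge-≢b : a ≢ b → ∀ j → merge a b j ≢ b
  merge-≢b a≢b j with j ≟ b
  ... | yes _   = a≢b
  ... | no  j≢b = j≢b

  merge≡a⁻ : ∀ {j} → merge a b j ≡ a → j ≡ a ⊎ j ≡ b
  merge≡a⁻ {j} eq with j ≟ b
  ... | yes j≡b = inj₂ j≡b
  ... | no  _   = inj₁ eq

  merge≡⁻ : ∀ {j k} → merge a b j ≡ k → k ≢ a → j ≡ k
  merge≡⁻ {j} eq k≢a with j ≟ b
  ... | yes _ = ⊥-elim (k≢a (sym eq))
  ... | no  _ = eq

module Contraction {n : ℕ} (K : Complex n) (a b : Fin n) (a≢b : a ≢ b) (ab : Face K (pair a b)) where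

  private
    F  = Face K
    Fc = Contract K a b
    m  = merge a b

  IsImage : Subset n → Subset n → Set
  IsImage σ τ = ∀ i → (i ∈ τ) ⇔ (∃ λ j → j ∈ σ × m j ≡ i)

  image-face : ∀ {σ τ} → F σ → (∀ k → k ∈ τ → ∃ λ l → l ∈ σ × m l ≡ k) →
               (∀ l → l ∈ σ → m l ∈ τ) → Fc τ
  image-face {σ} f onto into = σ , f , λ k → mk⇔ (onto k) λ { (l , l∈σ , refl) → into l l∈σ }

  image-vertex : ∀ {u i} → F ⁅ u ⁆ → m u ≡ i → Fc ⁅ i ⁆
  image-vertex {u} {i} f refl = image-face f
    (λ k k∈ → u , x∈⁅x⁆ u , sym (x∈⁅y⁆⇒x≡y i k∈))
    (λ { l l∈ → subst (λ z → m z ∈ ⁅ i ⁆) (sym (x∈⁅y⁆⇒x≡y u l∈)) (x∈⁅x⁆ i) })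

  image-edge : ∀ {u v i j} → F (pair u v) → m u ≡ i → m v ≡ j → Fc (pair i j)
  image-edge {u} {v} {i} {j} f refl refl = image-face f onto into
    where
    onto : ∀ k → k ∈ pair i j → ∃ λ l → l ∈ pair u v × m l ≡ k
    onto k k∈ with x∈pair⁻ k∈
    ... | inj₁ refl = u , u∈pair u v , refl
    ... | inj₂ refl = v , v∈pair u v , refl
    into : ∀ l → l ∈ pair u v → m l ∈ pair i j
    into l l∈ with x∈pair⁻ l∈
    ... | inj₁ refl = u∈pair i j
    ... | inj₂ refl = v∈pair i j

  face-avoiding-b : ∀ {τ} → F τ → (∀ i → i ∈ τ → i ≢ b) → Fc τ
  face-avoiding-b {τ} f ∌b = image-face f
    (λ k k∈ → k , k∈ , merge-fix (∌b k k∈))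
    (λ l l∈ → subst (_∈ τ) (sym (merge-fix (∌b l l∈))) l∈)

  preimage-∈ : ∀ {σ τ k} → IsImage σ τ → k ∈ τ → k ≢ a → k ∈ σ
  preimage-∈ {k = k} image k∈τ k≢a with Equivalence.to (image k) k∈τ
  ... | l , l∈σ , eq = subst (_∈ _) (merge≡⁻ eq k≢a) l∈σ

  a-vertex : IsVertex F a
  a-vertex = face-⊆ K ab (⁅x⁆⊆ (u∈pair a b))

  b-vertex : IsVertex F b
  b-vertex = face-⊆ K ab (⁅x⁆⊆ (v∈pair a b))

  contract-vertex : ∀ {i} → Fc ⁅ i ⁆ → i ≢ b × IsVertex F i
  contract-vertex {i} (σ , f , image) with Equivalence.to (image i) (x∈⁅x⁆ i)
  ... | l , l∈σ , refl = merge-≢b a≢b l , vertex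
    where
    vertex : IsVertex F (m l)
    vertex with l ≟ b
    ... | yes _ = a-vertex
    ... | no  _ = face-⊆ K f (⁅x⁆⊆ l∈σ)

  contract-edge : ∀ {i j} → i ≢ a → j ≢ a → Fc (pair i j) → F (pair i j)
  contract-edge {i} {j} i≢a j≢a (σ , f , image) =
    face-⊆ K f (pair⊆ (preimage-∈ image (u∈pair i j) i≢a) (preimage-∈ image (v∈pair i j) j≢a))

  contract-edge-a : ∀ {j} → j ≢ a → Fc (pair a j) → F (pair a j) ⊎ F (pair b j)
  contract-edge-a {j} j≢a (σ , f , image) with Equivalence.to (image a) (u∈pair a j)
  ... | l , l∈σ , eq with merge≡a⁻ {j = l} eq
  ...   | inj₁ refl = inj₁ (face-⊆ K f (pair⊆ l∈σ (preimage-∈ image (v∈pair a j) j≢a)))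
  ...   | inj₂ refl = inj₂ (face-⊆ K f (pair⊆ l∈σ (preimage-∈ image (v∈pair a j) j≢a)))

  triangle-not-face : ∀ {x y} → Square K a b x y → ¬ Fc (triple a x y)
  triangle-not-face {x} {y} sq (σ , f , image) with Equivalence.to (image a) (u∈triple a x y)
  ... | l , l∈σ , eq =
    [ (λ { refl → Square.no-diagonal₁₃ sq (face-⊆ K f (pair⊆ l∈σ x∈σ)) })
    , (λ { refl → Square.no-diagonal₂₄ sq (face-⊆ K f (pair⊆ l∈σ y∈σ)) })
    ] (merge≡a⁻ {j = l} eq)
    where
    x∈σ : x ∈ σ
    x∈σ = preimage-∈ image (v∈triple a x y) (≢-sym (square-opposite-≢ K sq))
    y∈σ : y ∈ σ
    y∈σ = preimage-∈ image (w∈triple a x y)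
            (square-adjacent-≢ K (square-rotate K (square-rotate K (square-rotate K sq))))

  square⇒¬flag : ∀ {x y} → Square K a b x y → ¬ Flag Fc
  square⇒¬flag {x} {y} sq flag = triangle-not-face sq (flag (triple a x y) vertices edges)
    where
    open Square sq
    x≢b : x ≢ b
    x≢b = ≢-sym (square-adjacent-≢ K (square-rotate K sq))
    y≢b : y ≢ b
    y≢b = ≢-sym (square-opposite-≢ K (square-rotate K sq))
    m-a : m a ≡ a
    m-a = merge-fix a≢b
    vertices : ∀ i → i ∈ triple a x y → IsVertex Fc i
    vertices = triple-all (image-vertex a-vertex m-a)
                          (image-vertex (face-⊆ K edge₂₃ (⁅x⁆⊆ (v∈pair b x))) (merge-fix x≢b))
                          (image-vertex (face-⊆ K edge₃₄ (⁅x⁆⊆ (v∈pair x y))) (merge-fix y≢b))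
    edges : ∀ i j → i ∈ triple a x y → j ∈ triple a x y → i ≢ j → Fc (pair i j)
    edges = triple-pairwise (subst Fc (pair-comm _ _))
                            (image-edge edge₂₃ (merge-b {b = b}) (merge-fix x≢b))
                            (image-edge (edge-comm K edge₄₁) m-a (merge-fix y≢b))
                            (image-edge edge₃₄ (merge-fix x≢b) (merge-fix y≢b))

  module Clique (flagK : Flag F) {τ : Subset n}
                (vertex : ∀ i → i ∈ τ → IsVertex Fc i)
                (edge : ∀ i j → i ∈ τ → j ∈ τ → i ≢ j → Fc (pair i j)) where

    ∌b : ∀ i → i ∈ τ → i ≢ b
    ∌b i i∈τ = proj₁ (contract-vertex (vertex i i∈τ))

    vertexK : ∀ i → i ∈ τ → IsVertex F i
    vertexK i i∈τ = proj₂ (contract-vertex (vertex i i∈τ))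

    edgeK : ∀ {i j} → i ∈ τ → j ∈ τ → i ≢ j → i ≢ a → j ≢ a → F (pair i j)
    edgeK {i} {j} i∈τ j∈τ i≢j i≢a j≢a = contract-edge i≢a j≢a (edge i j i∈τ j∈τ i≢j)

    face-without-a : a ∉ τ → Fc τ
    face-without-a a∉τ = face-avoiding-b (flagK τ vertexK edges) ∌b
      where
      edges : ∀ i j → i ∈ τ → j ∈ τ → i ≢ j → F (pair i j)
      edges i j i∈τ j∈τ i≢j =
        edgeK i∈τ j∈τ i≢j (λ { refl → a∉τ i∈τ }) (λ { refl → a∉τ j∈τ })

    -- τ with a replaced by c is a clique of K, and c merges to a.
    face-from-apex : a ∈ τ → ∀ {c} → m c ≡ a → IsVertex F c →
                     (∀ j → j ∈ τ → j ≢ a → F (pair c j)) → Fc τ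
    face-from-apex a∈τ {c} mc≡a c-vertex c-adjacent =
      image-face (flagK σ σ-vertex σ-edge) onto into
      where
      σ : Subset n
      σ = (τ ∩ ∁ ⁅ a ⁆) ∪ ⁅ c ⁆

      ∈σ⁻ : ∀ {l} → l ∈ σ → l ≡ c ⊎ (l ∈ τ × l ≢ a)
      ∈σ⁻ l∈σ with x∈p∪q⁻ (τ ∩ ∁ ⁅ a ⁆) ⁅ c ⁆ l∈σ
      ... | inj₂ l∈c = inj₁ (x∈⁅y⁆⇒x≡y c l∈c)
      ... | inj₁ l∈τ∖a with x∈p∩q⁻ τ (∁ ⁅ a ⁆) l∈τ∖a
      ...   | l∈τ , l∉a = inj₂ (l∈τ , λ { refl → x∈∁p⇒x∉p l∉a (x∈⁅x⁆ a) })

      ∈σ⁺ : ∀ {l} → l ∈ τ → l ≢ a → l ∈ σ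
      ∈σ⁺ {l} l∈τ l≢a = x∈p∪q⁺ (inj₁ (x∈p∩q⁺ (l∈τ , x∉p⇒x∈∁p (λ l∈a → l≢a (x∈⁅y⁆⇒x≡y a l∈a)))))

      σ-vertex : ∀ i → i ∈ σ → IsVertex F i
      σ-vertex i i∈σ with ∈σ⁻ i∈σ
      ... | inj₁ refl       = c-vertex
      ... | inj₂ (i∈τ , _) = vertexK i i∈τ

      σ-edge : ∀ i j → i ∈ σ → j ∈ σ → i ≢ j → F (pair i j)
      σ-edge i j i∈σ j∈σ i≢j with ∈σ⁻ i∈σ | ∈σ⁻ j∈σ
      ... | inj₁ refl         | inj₁ refl         = ⊥-elim (i≢j refl)
      ... | inj₁ refl         | inj₂ (j∈τ , j≢a) = c-adjacent j j∈τ j≢a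
      ... | inj₂ (i∈τ , i≢a) | inj₁ refl         = edge-comm K (c-adjacent i i∈τ i≢a)
      ... | inj₂ (i∈τ , i≢a) | inj₂ (j∈τ , j≢a) = edgeK i∈τ j∈τ i≢j i≢a j≢a

      onto : ∀ k → k ∈ τ → ∃ λ l → l ∈ σ × m l ≡ k
      onto k k∈τ with k ≟ a
      ... | yes refl = c , x∈p∪q⁺ (inj₂ (x∈⁅x⁆ c)) , mc≡a
      ... | no  k≢a  = k , ∈σ⁺ k∈τ k≢a , merge-fix (∌b k k∈τ)

      into : ∀ l → l ∈ σ → m l ∈ τ
      into l l∈σ with ∈σ⁻ l∈σ
      ... | inj₁ refl       = subst (_∈ τ) (sym mc≡a) a∈τ
      ... | inj₂ (l∈τ , _) = subst (_∈ τ) (sym (merge-fix (∌b l l∈τ))) l∈τ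

    square-from-counterexamples : ∀ {x y} → a ∈ τ →
                                  x ∈ τ → x ≢ a → ¬ F (pair a x) →
                                  y ∈ τ → y ≢ a → ¬ F (pair b y) → Square K a b x y
    square-from-counterexamples {x} {y} a∈τ x∈τ x≢a ¬ax y∈τ y≢a ¬by = record
      { edge₁₂ = ab ; edge₂₃ = bx ; edge₃₄ = edgeK x∈τ y∈τ x≢y x≢a y≢a ; edge₄₁ = edge-comm K ay
      ; no-diagonal₁₃ = ¬ax ; no-diagonal₂₄ = ¬by }
      where
      bx : F (pair b x)
      bx with contract-edge-a x≢a (edge a x a∈τ x∈τ (≢-sym x≢a))
      ... | inj₁ ax = ⊥-elim (¬ax ax)
      ... | inj₂ bx = bx
      ay : F (pair a y)
      ay with contract-edge-a y≢a (edge a y a∈τ y∈τ (≢-sym y≢a))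
      ... | inj₁ ay = ay
      ... | inj₂ by = ⊥-elim (¬by by)
      x≢y : x ≢ y
      x≢y refl = ¬by bx

    face : (∀ {x y} → ¬ Square K a b x y) → Fc τ
    face ¬square with a ∈? τ
    ... | no a∉τ = face-without-a a∉τ
    ... | yes a∈τ with adjacent-to-all-or-counterexample K τ a a
                     | adjacent-to-all-or-counterexample K τ a b
    ...   | inj₁ a-adjacent | _ = face-from-apex a∈τ (merge-fix a≢b) a-vertex a-adjacent
    ...   | inj₂ _ | inj₁ b-adjacent = face-from-apex a∈τ (merge-b {b = b}) b-vertex b-adjacent
    ...   | inj₂ (x , x∈τ , x≢a , ¬ax) | inj₂ (y , y∈τ , y≢a , ¬by) =
      ⊥-elim (¬square (square-from-counterexamples a∈τ x∈τ x≢a ¬ax y∈τ y≢a ¬by))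

  ¬square⇒flag : Flag F → (∀ {x y} → ¬ Square K a b x y) → Flag Fc
  ¬square⇒flag flagK ¬square τ vertex edge = Clique.face flagK vertex edge ¬square

lemma1 : (n : ℕ) (K : Complex n) → IsSphere2 K → Flag (Face K)
    → (a b : Fin n) → IsEdge (Face K) a b
    → Flag (Contract K a b) ⇔ (¬ EdgeInBelt K a b)
lemma1 n K _ flagK a b (a≢b , ab) = mk⇔ flag⇒¬belt ¬belt⇒flag
  where
  open Contraction K a b a≢b ab

  flag⇒¬belt : Flag (Contract K a b) → ¬ EdgeInBelt K a b
  flag⇒¬belt flag inBelt with edgeInBelt⇒square K inBelt
  ... | _ , _ , sq = square⇒¬flag sq flag

  ¬belt⇒flag : ¬ EdgeInBelt K a b → Flag (Contract K a b)
  ¬belt⇒flag ¬belt = ¬square⇒flag flagK (λ sq → ¬belt (square⇒edgeInBelt K sq))
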